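{- Let $\mathcal{P}$ be a client/server system, $s$ a global state of $\mathrm{TS}(\mathcal{P})$ and $b\in\mathit{enabled}(s)$. Then $\mathit{closure}(s,b)\cap\mathit{enabled}(s)$ is a covering source set in $s$ (with respect to trace equivalence).
   Context: A client/server system $\mathcal{P}$: a finite set of processes $\mathit{Proc}=\mathit{Clients}\cup\mathit{Servers}$ (disjoint), each $p$ with a finite action-deterministic transition system $\mathrm{TS}_p$ over actions $\Sigma_p$, clients' systems acyclic; $\mathit{dom}(a)=\{p:a\in\Sigma_p\}$ consists of exactly one client and one server. $\mathrm{TS}(\mathcal{P})$: global states are tuples $(s_p)_p$, $s\xrightarrow{a}s'$ iff $s_p\xrightarrow{a}s'_p$ in $\mathrm{TS}_p$ for $p\in\mathit{dom}(a)$ and $s'_p=s_p$ otherwise. We write $s_p\xrightarrow{a}_p$ if $s_p$ has an outgoing $a$-transition in $\mathrm{TS}_p$, and $\xrightarrow{}^*_p$ for a (possibly empty) path in $\mathrm{TS}_p$. $\mathit{enabled}(s)$ is the set of labels of transitions leaving $s$ in $\mathrm{TS}(\mathcal{P})$. A run is a path; a maximal run ends in a state without outgoing transitions. Actions $a,b$ are independent if $\mathit{dom}(a)\cap\mathit{dom}(b)=\emptyset$; $u\sim w$ if $w$ is obtained from $u$ by repeatedly swapping adjacent independent actions; $\mathit{first}(u)=\{c:\exists v.\ cv\sim u\}$. A set of actions $B$ is a covering source set in $s$ if $B\cap\mathit{first}(u)\neq\emptyset$ for every maximal run $u$ from $s$. $\mathit{closure}(s,b)$ is the smallest set of actions $C$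 such that: $C$ contains $\{a:\exists p\in\mathit{dom}(b).\ s_p\xrightarrow{a}_p\}$; and for every $b'\in C$ with $\mathit{dom}(b')=\{p,q\}$, if $s_p\xrightarrow{b'}_p$ and $s_q\xrightarrow{c}_q\xrightarrow{}^*_q\xrightarrow{b'}_q$, then $c\in C$. -}

module Defs where

open import Data.Nat using (ℕ)
open import Data.Fin using (Fin)
open import Data.Bool using (Bool; true; false)
open import Data.Maybe using (Maybe; just)
open import Data.List using (List; []; _∷_; _++_)
open import Data.Product using (Σ; ∃; ∃-syntax; _×_; _,_)
open import Data.Sum using (_⊎_)
open import Data.Empty using (⊥)
open import Relation.Nullary using (¬_)
open import Relation.Binary.PropositionalEquality using (_≡_; _≢_)
open import Relation.Binary.Construct.Closure.ReflexiveTransitive using (Star)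
open import Function.Bundles using (_⇔_)

data Path {S A : Set} (δ : S → A → Maybe S) : S → S → Set where
  nil  : ∀ {x} → Path δ x x
  cons : ∀ {x y z} (a : A) → δ x a ≡ just y → Path δ y z → Path δ x z

data Path⁺ {S A : Set} (δ : S → A → Maybe S) : S → S → Set where
  path⁺ : ∀ {x y z} (a : A) → δ x a ≡ just y → Path δ y z → Path⁺ δ x z

-- A client/server system.  Processes are Fin nP, actions Fin nA (all actions
-- of the system), local states of p are Fin (nS p).  Action-determinism is
-- built in: δ p is a partial function.
record CSSystem : Set₁ where
  field
    nP       : ℕ
    nA       : ℕ
    isClient : Fin nP → Bool
    nS       : Fin nP → ℕ
    δ        : (p : Fin nP) → Fin (nS p) → Fin nA → Maybe (Fin (nS p))
    inΣ      : Fin nP → Fin nA → Bool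
    δ-alph   : ∀ p x a y → δ p x a ≡ just y → inΣ p a ≡ true
    dom-cs   : ∀ a → Σ (Fin nP) λ c → Σ (Fin nP) λ sv →
                 isClient c ≡ true × isClient sv ≡ false ×
                 (∀ p → (inΣ p a ≡ true) ⇔ (p ≡ c ⊎ p ≡ sv))
    acyclic  : ∀ p → isClient p ≡ true → ∀ x → ¬ Path⁺ (δ p) x x

module _ (P : CSSystem) where
  open CSSystem P

  Proc : Set
  Proc = Fin nP

  Act : Set
  Act = Fin nA

  Dom : Act → Proc → Set
  Dom a p = inΣ p a ≡ true

  GState : Set
  GState = (p : Proc) → Fin (nS p)

  Step : GState → Act → GState → Set
  Step s a t = ∀ p → (inΣ p a ≡ true → δ p (s p) a ≡ just (t p))
                   × (inΣ p a ≡ false → t p ≡ s p)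

  Enabled : GState → Act → Set
  Enabled s a = ∃[ t ] Step s a t

  LocEnabled : (p : Proc) → Fin (nS p) → Act → Set
  LocEnabled p x a = ∃[ y ] δ p x a ≡ just y

  data RunTo : GState → List Act → GState → Set where
    nil  : ∀ {s} → RunTo s [] s
    cons : ∀ {s a t u r} → Step s a t → RunTo t u r → RunTo s (a ∷ u) r

  MaximalRun : GState → List Act → Set
  MaximalRun s u = ∃[ t ] (RunTo s u t × (∀ a → ¬ Enabled t a))

  Indep : Act → Act → Set
  Indep a b = ∀ p → Dom a p → Dom b p → ⊥

  data Swap : List Act → List Act → Set where
    swap : ∀ u v a b → Indep a b → Swap (u ++ a ∷ b ∷ v) (u ++ b ∷ a ∷ v)

  _∼_ : List Act → List Act → Set
  _∼_ = Star Swap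

  First : List Act → Act → Set
  First u c = ∃[ v ] (c ∷ v) ∼ u

  CoveringSource : GState → (Act → Set) → Set
  CoveringSource s B = ∀ u → MaximalRun s u → ∃[ c ] (B c × First u c)

  data Closure (s : GState) (b : Act) : Act → Set where
    base : ∀ {a} p → Dom b p → LocEnabled p (s p) a → Closure s b a
    step : ∀ {b' c} p q → Closure s b b' → Dom b' p → Dom b' q → p ≢ q →
           LocEnabled p (s p) b' →
           ∀ {x y} → δ q (s q) c ≡ just x → Path (δ q) x y → LocEnabled q y b' →
           Closure s b c

-- Let u be a maximal run from s. Since b is enabled in s and stays enabled as long as no
-- process of dom(b) moves, u contains a first action x touching some p ∈ dom(b); x is
-- locally enabled at s_p, so x ∈ closure(s,b). Now follow the chain backwards: if a ∈
-- closure(s,b) occurs in u after a prefix w that does not touch p ∈ dom(a), either w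
-- does not touch dom(a) at all — then a commutes to the front of u and is enabled in s —
-- or the first action x of w touching some q ∈ dom(a) is locally enabled at s_q and q
-- then moves along w to a state where a is enabled, so x ∈ closure(s,b) by the second
-- closure rule, and we recurse on the strictly shorter prefix before x.
module Submission where

open import Defs
open import Data.Bool using (true; false; if_then_else_)
open import Data.Bool.Properties using (¬-not) renaming (_≟_ to _≟ᵇ_)
open import Data.Empty using (⊥-elim)
open import Data.Fin.Properties using (any?)
open import Data.List using (List; []; _∷_; _++_; length)
open import Data.List.Properties using (++-assoc; length-++-≤ˡ; length-++-sucʳ)
open import Data.List.Relation.Unary.All as All using (All; []; _∷_)
open import Data.List.Relation.Unary.All.Properties using (++⁻ʳ)
open import Data.List.Relation.Unary.First as First′ using (FirstView; first)
open import Data.List.Relation.Unary.First.Properties using (toView)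
open import Data.Maybe using (just)
open import Data.Nat using (_<_; s≤s)
open import Data.Nat.Induction using (<-wellFounded)
open import Data.Product using (_×_; _,_; proj₁; proj₂; ∃-syntax)
open import Data.Sum using (_⊎_; inj₁; inj₂)
open import Function.Bundles using (_⇔_; mk⇔; Equivalence)
open import Induction.WellFounded using (Acc; acc)
open import Relation.Binary.Construct.Closure.ReflexiveTransitive using (ε; _◅_; gmap)
open import Relation.Binary.PropositionalEquality using (_≡_; _≢_; refl; sym; trans; subst)
open import Relation.Nullary using (¬_; yes; no; _×-dec_)

module _ (P : CSSystem) where
  open CSSystem P

  Untouched : Proc P → List (Act P) → Set
  Untouched p = All (λ x → ¬ Dom P x p)

  Dependent : Act P → Act P → Set
  Dependent a x = ∃[ r ] (Dom P a r × Dom P x r)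

  indep-or-dependent : ∀ a x → Indep P a x ⊎ Dependent a x
  indep-or-dependent a x with any? (λ r → (inΣ r a ≟ᵇ true) ×-dec (inΣ r x ≟ᵇ true))
  ... | yes dep = inj₂ dep
  ... | no ¬dep = inj₁ λ r da dx → ¬dep (r , da , dx)

  independent-or-first-dependent : ∀ a w →
    All (Indep P a) w ⊎ FirstView (Indep P a) (Dependent a) w
  independent-or-first-dependent a w with first (indep-or-dependent a) w
  ... | inj₁ dep   = inj₂ (toView dep)
  ... | inj₂ indep = inj₁ indep

  untouched-by-independent : ∀ {a r w} → Dom P a r → All (Indep P a) w → Untouched r w
  untouched-by-independent {r = r} da = All.map (λ indep → indep r da)

  untouched-state : ∀ {s w t} p → RunTo P s w t → Untouched p w → t p ≡ s p
  untouched-state p nil [] = refl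
  untouched-state p (cons s→t t→u) (¬da ∷ untouched) =
    trans (untouched-state p t→u untouched) (proj₂ (s→t p) (¬-not ¬da))

  local-path : ∀ {s w t} p → RunTo P s w t → Path (δ p) (s p) (t p)
  local-path p nil = nil
  local-path p (cons {a = a} s→t t→u) with inΣ p a in da
  ... | true  = cons a (proj₁ (s→t p) da) (local-path p t→u)
  ... | false = subst (λ x → Path (δ p) x _) (proj₂ (s→t p) da) (local-path p t→u)

  split-run : ∀ {s u} w₁ x w₂ → RunTo P s (w₁ ++ x ∷ w₂) u →
    ∃[ t ] ∃[ t' ] (RunTo P s w₁ t × Step P t x t' × RunTo P t' w₂ u)
  split-run []       x w₂ (cons s→t' t'→u) = _ , _ , nil , s→t' , t'→u
  split-run (y ∷ w₁) x w₂ (cons s→r r→u) with split-run w₁ x w₂ r→u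
  ... | t , t' , r→t , t→t' , t'→u = t , t' , cons s→r r→t , t→t' , t'→u

  loc-enabled-before : ∀ {s w t t' a p} → RunTo P s w t → Untouched p w →
    Step P t a t' → Dom P a p → LocEnabled P p (s p) a
  loc-enabled-before {t' = t'} {a} {p} s→t untouched t→t' da =
    t' p , subst (λ x → δ p x a ≡ just (t' p)) (untouched-state p s→t untouched) (proj₁ (t→t' p) da)

  enabled-if-agree-on-dom : ∀ {s t a} → (∀ r → Dom P a r → s r ≡ t r) →
    Enabled P s a → Enabled P t a
  enabled-if-agree-on-dom {s} {t} {a} agree (s' , s→s') = t' , t→t'
    where
    t' : GState P
    t' r = if inΣ r a then s' r else t r

    t→t' : Step P t a t'
    t→t' r with inΣ r a in da
    ... | true  = (λ _ → subst (λ x → δ r x a ≡ just (s' r)) (agree r da) (proj₁ (s→s' r) da))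
                , (λ ())
    ... | false = (λ ()) , (λ _ → refl)

  enabled-along-independent : ∀ {s w t a} → RunTo P s w t → All (Indep P a) w →
    Enabled P s a ⇔ Enabled P t a
  enabled-along-independent {s} {t = t} {a} s→t indep =
    mk⇔ (enabled-if-agree-on-dom (λ r ar → sym (agree r ar))) (enabled-if-agree-on-dom agree)
    where
    agree : ∀ r → Dom P a r → t r ≡ s r
    agree r ar = untouched-state r s→t (untouched-by-independent ar indep)

  ∼-cons : ∀ x {u w} → _∼_ P u w → _∼_ P (x ∷ u) (x ∷ w)
  ∼-cons x = gmap (x ∷_) λ { (swap u v a b i) → swap (x ∷ u) v a b i }

  first-after-independent : ∀ {c} w rest → All (Indep P c) w → First P (w ++ c ∷ rest) c
  first-after-independent {c} w rest indep = w ++ rest , commute w indep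
    where
    commute : ∀ w → All (Indep P c) w → _∼_ P (c ∷ w ++ rest) (w ++ c ∷ rest)
    commute []      []            = ε
    commute (x ∷ w) (c∥x ∷ indep) = swap [] (w ++ rest) c x c∥x ◅ ∼-cons x (commute w indep)

  prefix-shorter : ∀ (w₁ : List (Act P)) x w₂ → length w₁ < length (w₁ ++ x ∷ w₂)
  prefix-shorter w₁ x w₂ =
    subst (length w₁ <_) (sym (length-++-sucʳ w₁ x w₂)) (s≤s (length-++-≤ˡ w₁))

  module _ (s : GState P) (b : Act P) where

    closure-of-first-dependent : ∀ {w₁ x w₂ t₁ t₂ t t' a p q} →
      RunTo P s w₁ t₁ → Step P t₁ x t₂ → RunTo P t₂ w₂ t → Step P t a t' →
      All (Indep P a) w₁ → Closure P s b a → Dom P a p → LocEnabled P p (s p) a →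
      ¬ Dom P x p → Dom P a q → Dom P x q → Closure P s b x
    closure-of-first-dependent {t' = t'} {p = p} {q}
      s→t₁ t₁→t₂ t₂→t t→t' indep a∈C ap a-local ¬xp aq xq =
      step p q a∈C ap aq p≢q a-local
        (proj₂ (loc-enabled-before s→t₁ (untouched-by-independent aq indep) t₁→t₂ xq))
        (local-path q t₂→t) (t' q , proj₁ (t→t' q) aq)
      where
      p≢q : p ≢ q
      p≢q refl = ¬xp xq

    closure-reaches-first : ∀ w → Acc _<_ (length w) → ∀ {t t' a p} rest →
      RunTo P s w t → Step P t a t' → Closure P s b a → Dom P a p → Untouched p w →
      ∃[ c ] ((Closure P s b c × Enabled P s c) × First P (w ++ a ∷ rest) c)
    closure-reaches-first w (acc smaller) rest s→t t→t' a∈C ap p-untouched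
      with independent-or-first-dependent _ w
    ... | inj₁ indep =
      _ , (a∈C , Equivalence.from (enabled-along-independent s→t indep) (_ , t→t')) ,
      first-after-independent w rest indep
    ... | inj₂ (First′._++_∷_ {w₁} {x} indep (q , aq , xq) w₂)
      with split-run w₁ x w₂ s→t
    ... | _ , _ , s→t₁ , t₁→t₂ , t₂→t
      with closure-reaches-first w₁ (smaller (prefix-shorter w₁ x w₂)) (w₂ ++ _ ∷ rest)
             s→t₁ t₁→t₂
             (closure-of-first-dependent s→t₁ t₁→t₂ t₂→t t→t' indep a∈C ap
               (loc-enabled-before s→t p-untouched t→t' ap) (All.head (++⁻ʳ w₁ p-untouched)) aq xq)
             xq (untouched-by-independent aq indep)
    ... | c , c-good , c-first =
      c , c-good , subst (λ u → First P u c) (sym (++-assoc w₁ (x ∷ w₂) _)) c-first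

lemma10p2 : (P : CSSystem) (s : GState P) (b : Act P) → Enabled P s b →
    CoveringSource P s (λ a → Closure P s b a × Enabled P s a)
lemma10p2 P s b b-enabled u (t , s→t , stuck) with independent-or-first-dependent P b u
... | inj₁ indep =
  ⊥-elim (stuck b (Equivalence.to (enabled-along-independent P s→t indep) b-enabled))
... | inj₂ (First′._++_∷_ {w₁} {x} indep (p , db , xp) w₂) with split-run P w₁ x w₂ s→t
... | t₁ , t₂ , s→t₁ , t₁→t₂ , _ =
  closure-reaches-first P s b w₁ (<-wellFounded _) w₂ s→t₁ t₁→t₂
    (base p db (loc-enabled-before P s→t₁ p-untouched t₁→t₂ xp)) xp p-untouched
  where
  p-untouched : Untouched P p w₁
  p-untouched = untouched-by-independent P db indep
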